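{- Let $k\ge 3$ and let $D$ be a $k$-partite tournament. Then each connected component of $\mathcal{N}(D)$ has diameter at most $4$.
   Context: A $k$-partite tournament is an orientation of a complete $k$-partite graph with $k$ nonempty partite sets. The niche graph $\mathcal{N}(D)$ of a digraph $D$ has vertex set $V(D)$, and two distinct vertices are adjacent iff they have a common out-neighbor in $D$ or a common in-neighbor in $D$. -}

module Defs where

open import Data.Nat using (ℕ; zero; suc; _≤_)
open import Data.Fin using (Fin)
open import Data.Product using (Σ; ∃; _×_; _,_)
open import Data.Sum using (_⊎_)
open import Relation.Nullary using (¬_)
open import Relation.Binary.PropositionalEquality using (_≡_; _≢_)

Digraph : ℕ → Set₁
Digraph n = Fin n → Fin n → Set

record IsMultipartiteTournament {n : ℕ} (k : ℕ) (D : Digraph n) : Set where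
  field
    part       : Fin n → Fin k
    part-surj  : ∀ (i : Fin k) → ∃ λ v → part v ≡ i
    no-inner   : ∀ u v → part u ≡ part v → ¬ D u v
    some-arc   : ∀ u v → part u ≢ part v → D u v ⊎ D v u
    no-2cycle  : ∀ u v → ¬ (D u v × D v u)

NicheAdj : ∀ {n} → Digraph n → Fin n → Fin n → Set
NicheAdj D u v = u ≢ v × ((∃ λ w → D u w × D v w) ⊎ (∃ λ w → D w u × D w v))

data Walk {n : ℕ} (G : Fin n → Fin n → Set) : ℕ → Fin n → Fin n → Set where
  [] : ∀ {u} → Walk G zero u u
  _∷_ : ∀ {ℓ u v w} → G u v → Walk G ℓ v w → Walk G (suc ℓ) u w

Connected : ∀ {n} → (Fin n → Fin n → Set) → Fin n → Fin n → Set
Connected G u v = ∃ λ ℓ → Walk G ℓ u v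

DistAtMost : ∀ {n} → (Fin n → Fin n → Set) → ℕ → Fin n → Fin n → Set
DistAtMost G d u v = ∃ λ ℓ → ℓ ≤ d × Walk G ℓ u v

-- Any niche-graph walk of length 5 from x₀ to x₅ can be shortened, because a
-- common neighbour of xᵢ and xⱼ with j ≥ i + 2 cuts the walk to length ≤ 4.
-- Assuming no such shortcut exists, the triples {x₀,x₂,x₅}, {x₀,x₃,x₅} and
-- {x₁,x₃,x₅} have no pair with a common neighbour. In a multipartite
-- tournament such a triple meets three different partite sets and every other
-- vertex lies in one of them (a vertex outside them is joined to all three,
-- and two of these arcs point the same way). Hence x₂ shares a part with x₃
-- and x₀ with x₁, and then the common neighbour of x₁ and x₂ is also a common
-- neighbour of one of the pairs {x₀,x₂}, {x₁,x₃}, {x₀,x₃}.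
module Submission where

open import Defs
open import Data.Nat using (ℕ; suc; _+_; _≤_; _≤?_; z≤n; s≤s)
open import Data.Nat.Properties using (≤-trans; +-monoʳ-≤; n≤1+n; m≤n⇒m<n∨m≡n)
open import Data.Fin using (Fin; zero; suc)
open import Data.Fin.Properties using (_≟_)
open import Data.Product using (∃; _×_; _,_)
open import Data.Sum using (_⊎_; inj₁; inj₂; [_,_]′)
open import Data.Empty using (⊥; ⊥-elim)
open import Relation.Nullary using (yes; no)
open import Relation.Nullary.Decidable using (True; toWitness)
open import Relation.Binary.PropositionalEquality using (_≡_; _≢_; refl; sym; trans)

three-distinct-not-in-pair : ∀ {a} {A : Set a} {x y z p q : A} →
  x ≢ y → x ≢ z → y ≢ z →
  x ≡ p ⊎ x ≡ q → y ≡ p ⊎ y ≡ q → z ≡ p ⊎ z ≡ q → ⊥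
three-distinct-not-in-pair x≢y _   _   (inj₁ refl) (inj₁ refl) _           = x≢y refl
three-distinct-not-in-pair x≢y _   _   (inj₂ refl) (inj₂ refl) _           = x≢y refl
three-distinct-not-in-pair _   x≢z _   (inj₁ refl) (inj₂ refl) (inj₁ refl) = x≢z refl
three-distinct-not-in-pair _   _   y≢z (inj₁ refl) (inj₂ refl) (inj₂ refl) = y≢z refl
three-distinct-not-in-pair _   _   y≢z (inj₂ refl) (inj₁ refl) (inj₁ refl) = y≢z refl
three-distinct-not-in-pair _   x≢z _   (inj₂ refl) (inj₁ refl) (inj₂ refl) = x≢z refl

module _ {n : ℕ} {G : Fin n → Fin n → Set} where

  _++ʷ_ : ∀ {ℓ₁ ℓ₂ s u t} → Walk G ℓ₁ s u → Walk G ℓ₂ u t → Walk G (ℓ₁ + ℓ₂) s t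
  []      ++ʷ q = q
  (e ∷ p) ++ʷ q = e ∷ (p ++ʷ q)

  walk-bridge : ∀ {ℓ₁ ℓ₂ d s a b t} → ℓ₁ + suc ℓ₂ ≤ d →
    Walk G ℓ₁ s a → Walk G ℓ₂ b t → a ≡ b ⊎ G a b → DistAtMost G d s t
  walk-bridge {ℓ₁} {ℓ₂} ℓ≤d p q (inj₁ refl) =
    ℓ₁ + ℓ₂ , ≤-trans (+-monoʳ-≤ ℓ₁ (n≤1+n ℓ₂)) ℓ≤d , p ++ʷ q
  walk-bridge {ℓ₁} {ℓ₂} ℓ≤d p q (inj₂ e) = ℓ₁ + suc ℓ₂ , ℓ≤d , p ++ʷ (e ∷ q)

  walk⇒distAtMost : ∀ {d} → (∀ {s t} → Walk G (suc d) s t → DistAtMost G d s t) →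
    ∀ {ℓ s t} → Walk G ℓ s t → DistAtMost G d s t
  walk⇒distAtMost shorten []      = 0 , z≤n , []
  walk⇒distAtMost shorten (e ∷ p) with walk⇒distAtMost shorten p
  ... | ℓ , ℓ≤d , q with m≤n⇒m<n∨m≡n ℓ≤d
  ...   | inj₁ ℓ<d  = suc ℓ , ℓ<d , e ∷ q
  ...   | inj₂ refl = shorten (e ∷ q)

CommonNeighbour : ∀ {n} → Digraph n → Fin n → Fin n → Set
CommonNeighbour D a b = (∃ λ w → D a w × D b w) ⊎ (∃ λ w → D w a × D w b)

CommonNeighbourAmong : ∀ {n} → Digraph n → Fin n → Fin n → Fin n → Set
CommonNeighbourAmong D a b c =
  CommonNeighbour D a b ⊎ CommonNeighbour D a c ⊎ CommonNeighbour D b c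

module _ {n : ℕ} {D : Digraph n} where

  commonNeighbour-sym : ∀ {a b} → CommonNeighbour D a b → CommonNeighbour D b a
  commonNeighbour-sym (inj₁ (w , aw , bw)) = inj₁ (w , bw , aw)
  commonNeighbour-sym (inj₂ (w , wa , wb)) = inj₂ (w , wb , wa)

  commonNeighbour⇒≡⊎nicheAdj : ∀ {a b} → CommonNeighbour D a b → a ≡ b ⊎ NicheAdj D a b
  commonNeighbour⇒≡⊎nicheAdj {a} {b} c with a ≟ b
  ... | yes a≡b = inj₁ a≡b
  ... | no  a≢b = inj₂ (a≢b , c)

module _ {k n : ℕ} {D : Digraph n} (T : IsMultipartiteTournament k D) where

  open IsMultipartiteTournament T

  arc⇒≢part : ∀ {u v} → D u v → part u ≢ part v
  arc⇒≢part {u} {v} uv eq = no-inner u v eq uv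

  outsider⇒commonNeighbourAmong : ∀ {a b c w} →
    part w ≢ part a → part w ≢ part b → part w ≢ part c → CommonNeighbourAmong D a b c
  outsider⇒commonNeighbourAmong {a} {b} {c} {w} w≁a w≁b w≁c
    with some-arc w a w≁a | some-arc w b w≁b | some-arc w c w≁c
  ... | inj₁ wa | inj₁ wb | _       = inj₁ (inj₂ (w , wa , wb))
  ... | inj₂ aw | inj₂ bw | _       = inj₁ (inj₁ (w , aw , bw))
  ... | inj₁ wa | inj₂ _  | inj₁ wc = inj₂ (inj₁ (inj₂ (w , wa , wc)))
  ... | inj₁ _  | inj₂ bw | inj₂ cw = inj₂ (inj₂ (inj₁ (w , bw , cw)))
  ... | inj₂ _  | inj₁ wb | inj₁ wc = inj₂ (inj₂ (inj₂ (w , wb , wc)))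
  ... | inj₂ aw | inj₁ _  | inj₂ cw = inj₂ (inj₁ (inj₁ (w , aw , cw)))

  inPartOf⊎commonNeighbourAmong : ∀ a b c w →
    (part w ≡ part a ⊎ part w ≡ part b ⊎ part w ≡ part c) ⊎ CommonNeighbourAmong D a b c
  inPartOf⊎commonNeighbourAmong a b c w with part w ≟ part a | part w ≟ part b | part w ≟ part c
  ... | yes w∼a | _       | _       = inj₁ (inj₁ w∼a)
  ... | no _    | yes w∼b | _       = inj₁ (inj₂ (inj₁ w∼b))
  ... | no _    | no _    | yes w∼c = inj₁ (inj₂ (inj₂ w∼c))
  ... | no w≁a  | no w≁b  | no w≁c  = inj₂ (outsider⇒commonNeighbourAmong w≁a w≁b w≁c)

  -- Otherwise every vertex lies in the part of a or of c, leaving a partite set empty.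
  samePart⇒commonNeighbourAmong : 3 ≤ k → ∀ {a b c} → part a ≡ part b → CommonNeighbourAmong D a b c
  samePart⇒commonNeighbourAmong (s≤s (s≤s (s≤s _))) {a} {b} {c} a∼b
    with inTwoParts zero | inTwoParts (suc zero) | inTwoParts (suc (suc zero))
    where
    inTwoParts : ∀ i → (i ≡ part a ⊎ i ≡ part c) ⊎ CommonNeighbourAmong D a b c
    inTwoParts i with part-surj i
    ... | w , refl with inPartOf⊎commonNeighbourAmong a b c w
    ...   | inj₁ (inj₁ w∼a)        = inj₁ (inj₁ w∼a)
    ...   | inj₁ (inj₂ (inj₁ w∼b)) = inj₁ (inj₁ (trans w∼b (sym a∼b)))
    ...   | inj₁ (inj₂ (inj₂ w∼c)) = inj₁ (inj₂ w∼c)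
    ...   | inj₂ meet              = inj₂ meet
  ... | inj₁ i₀ | inj₁ i₁ | inj₁ i₂ = ⊥-elim (three-distinct-not-in-pair (λ ()) (λ ()) (λ ()) i₀ i₁ i₂)
  ... | inj₂ meet | _         | _         = meet
  ... | inj₁ _    | inj₂ meet | _         = meet
  ... | inj₁ _    | inj₁ _    | inj₂ meet = meet

  commonNeighbour-across-parts : ∀ {x₀ x₁ x₂ x₃} → part x₀ ≡ part x₁ → part x₂ ≡ part x₃ →
    CommonNeighbour D x₁ x₂ →
    CommonNeighbour D x₀ x₂ ⊎ CommonNeighbour D x₁ x₃ ⊎ CommonNeighbour D x₀ x₃
  commonNeighbour-across-parts {x₀} {x₁} {x₂} {x₃} x₀∼x₁ x₂∼x₃ (inj₁ (w , x₁w , x₂w))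
    with some-arc x₀ w (λ e → arc⇒≢part x₁w (trans (sym x₀∼x₁) e))
       | some-arc x₃ w (λ e → arc⇒≢part x₂w (trans x₂∼x₃ e))
  ... | inj₁ x₀w | _        = inj₁ (inj₁ (w , x₀w , x₂w))
  ... | inj₂ _   | inj₁ x₃w = inj₂ (inj₁ (inj₁ (w , x₁w , x₃w)))
  ... | inj₂ wx₀ | inj₂ wx₃ = inj₂ (inj₂ (inj₂ (w , wx₀ , wx₃)))
  commonNeighbour-across-parts {x₀} {x₁} {x₂} {x₃} x₀∼x₁ x₂∼x₃ (inj₂ (w , wx₁ , wx₂))
    with some-arc x₀ w (λ e → arc⇒≢part wx₁ (trans (sym e) x₀∼x₁))
       | some-arc x₃ w (λ e → arc⇒≢part wx₂ (sym (trans x₂∼x₃ e)))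
  ... | inj₂ wx₀ | _        = inj₁ (inj₂ (w , wx₀ , wx₂))
  ... | inj₁ _   | inj₂ wx₃ = inj₂ (inj₁ (inj₂ (w , wx₁ , wx₃)))
  ... | inj₁ x₀w | inj₁ x₃w = inj₂ (inj₂ (inj₁ (w , x₀w , x₃w)))

  walk₅⇒distAtMost₄ : 3 ≤ k → ∀ {s t} → Walk (NicheAdj D) 5 s t → DistAtMost (NicheAdj D) 4 s t
  walk₅⇒distAtMost₄ 3≤k {x₀} {x₅}
    (_∷_ {v = x₁} e₁ (_∷_ {v = x₂} e₂@(_ , x₁⋈x₂) (_∷_ {v = x₃} e₃ (e₄ ∷ (e₅ ∷ []))))) =
    separate f₀₂ f₀₅ f₂₅ λ x₀≁x₂ →
    separate f₂₅ (far-sym f₀₂) (far-sym f₀₅) λ x₂≁x₅ →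
    separate f₀₃ f₀₅ f₃₅ λ x₀≁x₃ →
    separate f₀₅ f₀₂ (far-sym f₂₅) λ x₀≁x₅ →
    conclude x₀≁x₂ x₂≁x₅ x₀≁x₃ x₀≁x₅
    where
    R : Set
    R = DistAtMost (NicheAdj D) 4 x₀ x₅

    -- Constructive stand-in for "a and b have no common neighbour".
    Far : Fin n → Fin n → Set
    Far a b = CommonNeighbour D a b → R

    far : ∀ {ℓ₁ ℓ₂ a b} → Walk (NicheAdj D) ℓ₁ x₀ a → Walk (NicheAdj D) ℓ₂ b x₅ →
      {True (ℓ₁ + suc ℓ₂ ≤? 4)} → Far a b
    far p q {ℓ≤4} c = walk-bridge (toWitness ℓ≤4) p q (commonNeighbour⇒≡⊎nicheAdj c)

    far-sym : ∀ {a b} → Far a b → Far b a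
    far-sym f c = f (commonNeighbour-sym {D = D} c)

    f₀₂ : Far x₀ x₂
    f₀₂ = far [] (e₃ ∷ (e₄ ∷ (e₅ ∷ [])))
    f₀₃ : Far x₀ x₃
    f₀₃ = far [] (e₄ ∷ (e₅ ∷ []))
    f₀₅ : Far x₀ x₅
    f₀₅ = far [] []
    f₁₃ : Far x₁ x₃
    f₁₃ = far (e₁ ∷ []) (e₄ ∷ (e₅ ∷ []))
    f₁₅ : Far x₁ x₅
    f₁₅ = far (e₁ ∷ []) []
    f₂₅ : Far x₂ x₅
    f₂₅ = far (e₁ ∷ (e₂ ∷ [])) []
    f₃₅ : Far x₃ x₅
    f₃₅ = far (e₁ ∷ (e₂ ∷ (e₃ ∷ []))) []

    refute : ∀ {a b c} → Far a b → Far a c → Far b c → CommonNeighbourAmong D a b c → R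
    refute fab fac fbc = [ fab , [ fac , fbc ]′ ]′

    separate : ∀ {a b c} → Far a b → Far a c → Far b c → (part a ≢ part b → R) → R
    separate {a} {b} fab fac fbc otherwise with part a ≟ part b
    ... | yes a∼b = refute fab fac fbc (samePart⇒commonNeighbourAmong 3≤k a∼b)
    ... | no  a≁b = otherwise a≁b

    conclude : part x₀ ≢ part x₂ → part x₂ ≢ part x₅ → part x₀ ≢ part x₃ → part x₀ ≢ part x₅ → R
    conclude x₀≁x₂ x₂≁x₅ x₀≁x₃ x₀≁x₅ with part x₂ ≟ part x₃ | part x₀ ≟ part x₁
    ... | no x₂≁x₃  | _ =
      refute f₀₃ f₀₅ f₃₅ (outsider⇒commonNeighbourAmong (λ e → x₀≁x₂ (sym e)) x₂≁x₃ x₂≁x₅)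
    ... | yes _     | no x₀≁x₁ =
      refute f₁₃ f₁₅ f₃₅ (outsider⇒commonNeighbourAmong x₀≁x₁ x₀≁x₃ x₀≁x₅)
    ... | yes x₂∼x₃ | yes x₀∼x₁ =
      [ f₀₂ , [ f₁₃ , f₀₃ ]′ ]′ (commonNeighbour-across-parts x₀∼x₁ x₂∼x₃ x₁⋈x₂)

corollary4p5 : ∀ (k n : ℕ) → 3 ≤ k → (D : Digraph n) → IsMultipartiteTournament k D →
    ∀ (u v : Fin n) → Connected (NicheAdj D) u v → DistAtMost (NicheAdj D) 4 u v
corollary4p5 k n 3≤k D T u v (_ , walk) = walk⇒distAtMost (walk₅⇒distAtMost₄ T 3≤k) walk
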